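{- In the setting described in the context, for every good path $\pi$ with $lh(\pi)\leq 2$ and all $X\cup\{y\}\subseteq V$ (with $\mathbf{x}$ the fixed enumeration of $X$): if $(M_{cut},A_{cut}),v_\pi\models D_Xy$ then $M_{cut},v_\pi\models R^{X,y}\mathbf{x}$, i.e. $v_\pi(\mathbf{x})\in I^{M_{cut}}(R^{X,y})$.
   Context: LFD syntax: $\varphi::=P\mathbf{x}\mid\neg\varphi\mid\varphi\wedge\varphi\mid\mathbb{D}_X\varphi\mid D_Xy$ ($X$ finite set of variables, $y$ a variable, $P$ relational). Free variables: $Free(P x_1\dots x_n)=\{x_1,\dots,x_n\}$, $Free(D_Xy)=Free(\mathbb{D}_X\psi)=X$, Booleans by union. A dependence model $(M,A)$ is a $\tau$-structure $M$ with domain $O$ and team $A\subseteq O^V$; $s=_Xt$ iff $s\restriction X=t\restriction X$; $s\models P\mathbf{x}$ iff $s(\mathbf{x})\in P^M$; $s\models\mathbb{D}_X\psi$ iff $t\models\psi$ for all $t\in A$ with $s=_Xt$; $s\models D_Xy$ iff for all $t\in A$, $s=_Xt$ implies $s(y)=t(y)$. Setting: fix an LFD formula $\varphi$; let $V=V_\varphi$ (variables occurring in $\varphi$, finite) and $\tau=\tau_\varphi$. The closure $\Phi=Cl(\varphi)$ is obtained by adding to $\{\varphi\}$ all $D_Xy$ with $X\cup\{y\}\subseteq V$, closing under subformulas, and adding $\neg\psi$ for each non-negated $\psi$. A $\Phi$-type is $\Sigma\subseteq\Phi$ with: (a) $\neg\psi\in\Sigma$ iff $\psi\notin\Sigma$;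 (b) $\psi\wedge\chi\in\Sigma$ iff both are in $\Sigma$; (c) $\mathbb{D}_X\psi\in\Sigma$ implies $\psi\in\Sigma$; (d) $D_Xx\in\Sigma$ for $x\in X$; (e) $D_XY,D_YZ\in\Sigma$ implies $D_XZ\in\Sigma$ (where $D_XY$ means $D_Xy$ for all $y\in Y$), all formulas ranging over $\Phi$. Let $D^\Sigma_X=\{y\in V\mid D_Xy\in\Sigma\}$ and $\Sigma\sim_X\Delta$ iff $\{\psi\in\Sigma\mid Free(\psi)\subseteq D^\Sigma_X\}=\{\psi\in\Delta\mid Free(\psi)\subseteq D^\Sigma_X\}$. A type model is a set $\mathfrak{M}$ of $\Phi$-types such that if $\neg\mathbb{D}_X\neg\psi\in\Sigma\in\mathfrak{M}$ there is $\Delta\in\mathfrak{M}$ with $\psi\in\Delta$ and $\Sigma\sim_X\Delta$, and $\Sigma\sim_\emptyset\Delta$ for all $\Sigma,\Delta\in\mathfrak{M}$. Fix a type model $\mathfrak{M}$ and $\Sigma_0\in\mathfrak{M}$. A good path is a sequence $\pi=\langle\Sigma_0,X_1,\Sigma_1,\dots,X_n,\Sigma_n\rangle$ ($n\geq0$) with $\Sigma_i\in\mathfrak{M}$, $X_i\subseteq V$, $\Sigma_{i-1}\sim_{X_i}\Sigma_i$; $last(\pi)=\Sigma_n$, $lh(\pi)=n+1$. The path assignment $v_\pi:V\to\{\text{objects}\}$ is defined by: $v_{\langle\Sigma_0\rangle}(v)=(\langle\Sigma_0\rangle,v)$; if $\pi=(\pi',X,\Sigma)$ then $v_\pi(v)=v_{\pi'}(v)$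 if $v\in D^{last(\pi')}_X$ and $v_\pi(v)=(\pi,v)$ otherwise. The structure $M$ has domain $\bigcup_\pi v_\pi[V]$ and an $r$-ary $P\in\tau$ holds of $((\pi_1,x_1),\dots,(\pi_r,x_r))$ iff the $\pi_i$ are linearly ordered by initial segment and $Px_1\dots x_r\in last(\pi_j)$ for the longest $\pi_j$. Let $A_{cut}=\{v_\pi\mid lh(\pi)\leq3\}$ and $M_{cut}$ the induced substructure of $M$ on $\bigcup\{v_\pi[V]\mid v_\pi\in A_{cut}\}$. Expand $\tau$ to $\tau^+$ by an $|X|$-ary symbol $R^{X,y}$ for each $X\cup\{y\}\subseteq V$ (with a fixed enumeration $\mathbf{x}$ of $X$), interpreted in $M_{cut}$ by $I^{M_{cut}}(R^{X,y})=\{v_\pi(\mathbf{x})\mid v_\pi\in A_{cut},\ D_Xy\in last(\pi)\}$. $(M_{cut},A_{cut})$ is the cut-off dependence model. -}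

module Defs where

open import Data.Nat using (ℕ; zero; suc; _≤_)
open import Data.Bool using (Bool; true; false; not; _∧_; if_then_else_)
open import Data.Fin using (Fin)
import Data.Fin as F
open import Data.Fin.Subset using (Subset; inside; outside; _∈_; ⊥)
open import Data.Vec using ([]; _∷_)
open import Data.List using (List; []; _∷_; map)
import Data.List.Membership.Propositional as LM
open import Data.Product using (Σ; _×_; ∃; _,_)
open import Data.Sum using (_⊎_)
open import Data.Unit using (⊤)
open import Data.Empty renaming (⊥ to Empty)
open import Relation.Nullary using (¬_)
open import Relation.Binary.PropositionalEquality using (_≡_)

-- Variables are Fin n (n large enough to cover the
-- variables of φ); finite variable sets X are Subset n; relation
-- symbols are named by ℕ, the arity being the length of the argument list.

data Formula (n : ℕ) : Set where
  rel  : ℕ → List (Fin n) → Formula n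
  ¬'_  : Formula n → Formula n
  _∧'_ : Formula n → Formula n → Formula n
  𝔻    : Subset n → Formula n → Formula n
  D    : Subset n → Fin n → Formula n

module _ {n : ℕ} where

  -- x occurs in the formula (V_φ as a predicate)
  InV : Formula n → Fin n → Set
  InV (rel P xs) x = x LM.∈ xs
  InV (¬' ψ)     x = InV ψ x
  InV (ψ ∧' χ)   x = InV ψ x ⊎ InV χ x
  InV (𝔻 X ψ)    x = x ∈ X ⊎ InV ψ x
  InV (D X y)    x = x ∈ X ⊎ x ≡ y

  _⊆V_ : Subset n → Formula n → Set
  X ⊆V φ = ∀ x → x ∈ X → InV φ x

  _∈Fr_ : Fin n → Formula n → Set
  x ∈Fr rel P xs = x LM.∈ xs
  x ∈Fr (¬' ψ)   = x ∈Fr ψ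
  x ∈Fr (ψ ∧' χ) = x ∈Fr ψ ⊎ x ∈Fr χ
  x ∈Fr 𝔻 X ψ    = x ∈ X
  x ∈Fr D X y    = x ∈ X

  IsNeg : Formula n → Set
  IsNeg (¬' ψ) = ⊤
  IsNeg _      = Empty

  data Cl₀ (φ : Formula n) : Formula n → Set where
    base  : Cl₀ φ φ
    dep   : ∀ X y → X ⊆V φ → InV φ y → Cl₀ φ (D X y)
    sub¬  : ∀ {ψ} → Cl₀ φ (¬' ψ) → Cl₀ φ ψ
    sub∧ˡ : ∀ {ψ χ} → Cl₀ φ (ψ ∧' χ) → Cl₀ φ ψ
    sub∧ʳ : ∀ {ψ χ} → Cl₀ φ (ψ ∧' χ) → Cl₀ φ χ
    sub𝔻  : ∀ {X ψ} → Cl₀ φ (𝔻 X ψ) → Cl₀ φ ψ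

  Cl : Formula n → Formula n → Set
  Cl φ ψ = Cl₀ φ ψ ⊎ (Σ (Formula n) λ χ → Cl₀ φ χ × ¬ IsNeg χ × ψ ≡ (¬' χ))

  Ty : Set
  Ty = Formula n → Bool

  _∋_ : Ty → Formula n → Set
  S ∋ ψ = S ψ ≡ true

  InD : Formula n → Ty → Subset n → Fin n → Set
  InD φ S X y = InV φ y × S ∋ D X y

  Sim : Formula n → Ty → Subset n → Ty → Set
  Sim φ S X T = ∀ ψ → Cl φ ψ → (∀ z → z ∈Fr ψ → InD φ S X z) → S ψ ≡ T ψ

  record IsType (φ : Formula n) (S : Ty) : Set where
    field
      ⊆Φ    : ∀ ψ → S ∋ ψ → Cl φ ψ
      neg   : ∀ ψ → Cl φ (¬' ψ) → S (¬' ψ) ≡ not (S ψ)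
      conj  : ∀ ψ χ → Cl φ (ψ ∧' χ) → S (ψ ∧' χ) ≡ (S ψ ∧ S χ)
      box   : ∀ X ψ → Cl φ (𝔻 X ψ) → S ∋ 𝔻 X ψ → S ∋ ψ
      refl  : ∀ X x → X ⊆V φ → x ∈ X → S ∋ D X x
      trans : ∀ X Y Z → X ⊆V φ → Y ⊆V φ → Z ⊆V φ →
              (∀ y → y ∈ Y → S ∋ D X y) → (∀ z → z ∈ Z → S ∋ D Y z) →
              ∀ z → z ∈ Z → S ∋ D X z

  -- A type model 𝔐: a set of Φ-types, given by an injective indexing.
  record TypeModel (φ : Formula n) : Set₁ where
    field
      Idx     : Set
      typ     : Idx → Ty
      typ-inj : ∀ i j → (∀ ψ → typ i ψ ≡ typ j ψ) → i ≡ j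
      isType  : ∀ i → IsType φ (typ i)
      witness : ∀ i X ψ → typ i ∋ (¬' 𝔻 X (¬' ψ)) →
                Σ Idx λ j → typ j ∋ ψ × Sim φ (typ i) X (typ j)
      sim∅    : ∀ i j → Sim φ (typ i) ⊥ (typ j)

  -- Paths starting at the fixed Σ₀:  ⟨⟩ is ⟨Σ₀⟩, π ▷ X , Σ appends.
  data Path (I : Set) : Set where
    ⟨⟩      : Path I
    _▷_,_   : Path I → Subset n → I → Path I

  module Construction (φ : Formula n) (𝔐 : TypeModel φ) (Σ₀ : TypeModel.Idx 𝔐) where
    open TypeModel 𝔐

    last : Path Idx → Idx
    last ⟨⟩ = Σ₀
    last (π ▷ X , i) = i

    lh : Path Idx → ℕ
    lh ⟨⟩ = 1
    lh (π ▷ X , i) = suc (lh π)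

    Good : Path Idx → Set
    Good ⟨⟩ = ⊤
    Good (π ▷ X , i) = Good π × X ⊆V φ × Sim φ (typ (last π)) X (typ i)

    Obj : Set
    Obj = Path Idx × Fin n

    Assignment : Set
    Assignment = Fin n → Obj

    -- path assignment v_π (only its values on V_φ matter)
    vπ : Path Idx → Assignment
    vπ ⟨⟩ v = (⟨⟩ , v)
    vπ (π ▷ X , i) v = if typ (last π) (D X v) then vπ π v else ((π ▷ X , i) , v)

    Acut : Assignment → Set
    Acut t = Σ (Path Idx) λ π → Good π × lh π ≤ 3 × (∀ v → InV φ v → t v ≡ vπ π v)

    -- (M, A), s ⊨ D_X y  (depends only on the team A)
    SatD : (Assignment → Set) → Subset n → Fin n → Assignment → Set
    SatD A X y s = ∀ t → A t → (∀ x → x ∈ X → s x ≡ t x) → s y ≡ t y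

    enum : ∀ {m} → Subset m → List (Fin m)
    enum {zero} [] = []
    enum {suc m} (inside ∷ p) = F.zero ∷ map F.suc (enum p)
    enum {suc m} (outside ∷ p) = map F.suc (enum p)

    RInterp : Subset n → Fin n → List Obj → Set
    RInterp X y tup = Σ (Path Idx) λ π → Good π × lh π ≤ 3 ×
                      typ (last π) ∋ D X y × map (vπ π) (enum X) ≡ tup

-- If D_X y ∉ last(π), stutter: the good path π ▷ X , last(π) has length ≤ 3, so its
-- assignment lies in A_cut.  It inherits v_π on X (reflexivity of types) but sends y to
-- a fresh object, one never used by v_π, contradicting D_X y at v_π.  Hence D_X y ∈ last(π),
-- and v_π itself witnesses v_π(𝐱) ∈ I(R^{X,y}).
module Submission where

open import Defs
open import Data.Nat using (_≤_; s≤s)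
open import Data.Nat.Properties using (≤-refl; ≤-trans; ≤-reflexive; n≤1+n; 1+n≰n)
open import Data.Fin using (Fin)
open import Data.Fin.Subset using (Subset; _∈_)
open import Data.List using (map)
open import Data.Bool using (true; false)
open import Data.Product using (_,_; proj₁)
open import Data.Empty using (⊥-elim)
open import Relation.Binary.PropositionalEquality using (_≡_; _≢_; refl; cong; sym; trans)

module CutOffModel {n} (φ : Formula n) (𝔐 : TypeModel φ) (Σ₀ : TypeModel.Idx 𝔐) where
  open TypeModel 𝔐
  open Construction φ 𝔐 Σ₀

  vπ-▷-inherited : ∀ π X i v → typ (last π) ∋ D X v → vπ (π ▷ X , i) v ≡ vπ π v
  vπ-▷-inherited π X i v Dv rewrite Dv = refl

  vπ-▷-fresh : ∀ π X i v → typ (last π) (D X v) ≡ false → vπ (π ▷ X , i) v ≡ ((π ▷ X , i) , v)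
  vπ-▷-fresh π X i v ¬Dv rewrite ¬Dv = refl

  lh-vπ-≤ : ∀ π v → lh (proj₁ (vπ π v)) ≤ lh π
  lh-vπ-≤ ⟨⟩ v = ≤-refl
  lh-vπ-≤ (π ▷ X , i) v with typ (last π) (D X v)
  ... | true  = ≤-trans (lh-vπ-≤ π v) (n≤1+n (lh π))
  ... | false = ≤-refl

  vπ-≢-extension-object : ∀ π X i v w → vπ π v ≢ ((π ▷ X , i) , w)
  vπ-≢-extension-object π X i v w eq =
    1+n≰n (≤-trans (≤-reflexive (cong (λ o → lh (proj₁ o)) (sym eq))) (lh-vπ-≤ π v))

  vπ∈Acut : ∀ π → Good π → lh π ≤ 3 → Acut (vπ π)
  vπ∈Acut π g l = π , g , l , λ _ _ → refl

  stutter : Path Idx → Subset n → Path Idx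
  stutter π X = π ▷ X , last π

  stutter-good : ∀ π X → Good π → X ⊆V φ → Good (stutter π X)
  stutter-good π X g X⊆V = g , X⊆V , λ _ _ _ → refl

  stutter-agrees-on : ∀ π X → X ⊆V φ → ∀ x → x ∈ X → vπ π x ≡ vπ (stutter π X) x
  stutter-agrees-on π X X⊆V x x∈X =
    sym (vπ-▷-inherited π X (last π) x (IsType.refl (isType (last π)) X x X⊆V x∈X))

  dependence-in-last : ∀ π → Good π → lh π ≤ 2 → ∀ X y → X ⊆V φ →
    SatD Acut X y (vπ π) → typ (last π) ∋ D X y
  dependence-in-last π g l X y X⊆V sat with typ (last π) (D X y) in Dy
  ... | true  = refl
  ... | false = ⊥-elim (vπ-≢-extension-object π X (last π) y y
                  (trans same-y (vπ-▷-fresh π X (last π) y Dy)))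
    where
    same-y : vπ π y ≡ vπ (stutter π X) y
    same-y = sat (vπ (stutter π X)) (vπ∈Acut (stutter π X) (stutter-good π X g X⊆V) (s≤s l))
                 (stutter-agrees-on π X X⊆V)

proposition4p1 : ∀ {n} (φ : Formula n) (𝔐 : TypeModel φ) (Σ₀ : TypeModel.Idx 𝔐) →
    let open Construction φ 𝔐 Σ₀ in
    ∀ (π : Path (TypeModel.Idx 𝔐)) → Good π → lh π ≤ 2 →
    ∀ (X : Subset n) (y : Fin n) → X ⊆V φ → InV φ y →
    SatD Acut X y (vπ π) → RInterp X y (map (vπ π) (enum X))
proposition4p1 φ 𝔐 Σ₀ π g l X y X⊆V _ sat =
  π , g , ≤-trans l (n≤1+n 2) , dependence-in-last π g l X y X⊆V sat , refl
  where open CutOffModel φ 𝔐 Σ₀
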